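{- Let $(R,\mathfrak m)$ be an almost setup. For each $t\in\mathbb{N}$ let $$C_t:\ 0\to M_{t,1}\xrightarrow{\varphi_t}M_{t,2}\xrightarrow{\psi_t}M_{t,3}$$ be a complex of $R$-modules, and let $\omega_t:M_{t,i}\to M_{t-1,i}$ ($i=1,2,3$, $t\ge1$) be $R$-linear maps such that the resulting squares commute. If every $C_t$ is almost exact, then the inverse limit $\varprojlim_{t\in\mathbb{N}}C_t$ is almost exact.
   Context: An almost setup is a pair $(R,\mathfrak m)$ of a commutative ring $R$ and an ideal $\mathfrak m$ with $\mathfrak m^2=\mathfrak m$ and $\mathfrak m\otimes_R\mathfrak m$ flat over $R$. An $R$-module $M$ is almost zero if $\mathfrak mM=0$; the category of almost $R$-modules is the quotient of the category of $R$-modules by the Serre subcategory of almost zero modules, with quotient functor $M\mapsto M^{\mathrm{al}}$. A complex of $R$-modules is almost exact if its image under $M\mapsto M^{\mathrm{al}}$ is exact (equivalently, its cohomology modules are almost zero). -}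

module Defs where

open import Level using (Level; _⊔_; suc; Setω)
open import Data.Nat using (ℕ) renaming (suc to sucℕ)
open import Data.Product using (Σ; _×_; _,_; proj₁; proj₂; ∃)
open import Data.List using (List; []; _∷_; _++_; map; foldr)
open import Function using (flip)
open import Algebra.Bundles using (CommutativeRing)
open import Algebra.Module.Bundles using (Module)
open import Algebra.Module.Structures.Biased using (IsModuleFromLeft)
open import Algebra.Module.Morphism.Structures using (module ModuleMorphisms)

private
  variable
    a b a' b' : Level

module _ {c ℓ} (R : CommutativeRing c ℓ) where
  open CommutativeRing R

  record Ideal (p : Level) : Set (c ⊔ ℓ ⊔ suc p) where
    field
      _∈ᴵ     : Carrier → Set p
      ∈-resp : ∀ {x y} → x ≈ y → x ∈ᴵ → y ∈ᴵ
      0∈     : 0# ∈ᴵ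
      +∈     : ∀ {x y} → x ∈ᴵ → y ∈ᴵ → (x + y) ∈ᴵ
      *∈     : ∀ r {x} → x ∈ᴵ → (r * x) ∈ᴵ

  Elt : ∀ {p} → Ideal p → Set (c ⊔ p)
  Elt 𝔪 = Σ Carrier (Ideal._∈ᴵ 𝔪)

  -- 𝔪² = 𝔪 : every element of 𝔪 is a finite sum of products of two
  -- elements of 𝔪 (the inclusion 𝔪² ⊆ 𝔪 is automatic).
  IsIdempotent : ∀ {p} → Ideal p → Set (c ⊔ ℓ ⊔ p)
  IsIdempotent 𝔪 =
    ∀ x → x ∈ᴵ → ∃ λ (ps : List (Elt 𝔪 × Elt 𝔪)) →
      x ≈ foldr (λ uv s → proj₁ (proj₁ uv) * proj₁ (proj₂ uv) + s) 0# ps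
    where open Ideal 𝔪

  IsLinear : (M : Module R a b) (N : Module R a' b') →
             (Module.Carrierᴹ M → Module.Carrierᴹ N) → Set (c ⊔ a ⊔ b ⊔ b')
  IsLinear M N f =
    ModuleMorphisms.IsModuleHomomorphism (Module.rawModule M) (Module.rawModule N) f

  IsInjectiveLinear : (M : Module R a b) (N : Module R a' b') →
             (Module.Carrierᴹ M → Module.Carrierᴹ N) → Set (c ⊔ a ⊔ b ⊔ b')
  IsInjectiveLinear M N f =
    ModuleMorphisms.IsModuleMonomorphism (Module.rawModule M) (Module.rawModule N) f

  -- The tensor product 𝔪 ⊗_R 𝔪 ⊗_R N, presented as the free commutative
  -- monoid (lists) on triples u ⊗ v ⊗ n modulo the R-multilinearity
  -- relations.  (This is (𝔪 ⊗_R 𝔪) ⊗_R N up to the canonical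
  -- associativity isomorphism.)
  module _ {p} (𝔪 : Ideal p) (N : Module R a b) where
    open Module N

    Triple : Set (c ⊔ p ⊔ a)
    Triple = Elt 𝔪 × Elt 𝔪 × Carrierᴹ

    data _∼⊗_ : List Triple → List Triple → Set (c ⊔ ℓ ⊔ p ⊔ a ⊔ b) where
      ∼-refl  : ∀ {xs} → xs ∼⊗ xs
      ∼-sym   : ∀ {xs ys} → xs ∼⊗ ys → ys ∼⊗ xs
      ∼-trans : ∀ {xs ys zs} → xs ∼⊗ ys → ys ∼⊗ zs → xs ∼⊗ zs
      ∼-++    : ∀ {xs xs' ys ys'} → xs ∼⊗ xs' → ys ∼⊗ ys' →
                (xs ++ ys) ∼⊗ (xs' ++ ys')
      ∼-comm  : ∀ xs ys → (xs ++ ys) ∼⊗ (ys ++ xs)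
      ∼-cong  : ∀ {u u' v v' n n'} → proj₁ u ≈ proj₁ u' → proj₁ v ≈ proj₁ v' →
                n ≈ᴹ n' → ((u , v , n) ∷ []) ∼⊗ ((u' , v' , n') ∷ [])
      ∼-zero  : ∀ u v → ((u , v , 0ᴹ) ∷ []) ∼⊗ []
      ∼-add₁  : ∀ {u u' w} v n → proj₁ w ≈ proj₁ u + proj₁ u' →
                ((w , v , n) ∷ []) ∼⊗ ((u , v , n) ∷ (u' , v , n) ∷ [])
      ∼-add₂  : ∀ u {v v' w} n → proj₁ w ≈ proj₁ v + proj₁ v' →
                ((u , w , n) ∷ []) ∼⊗ ((u , v , n) ∷ (u , v' , n) ∷ [])
      ∼-add₃  : ∀ u v n n' →
                ((u , v , n +ᴹ n') ∷ []) ∼⊗ ((u , v , n) ∷ (u , v , n') ∷ [])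
      ∼-bal₁₂ : ∀ r {u ru v rv} n → proj₁ ru ≈ r * proj₁ u →
                proj₁ rv ≈ r * proj₁ v →
                ((ru , v , n) ∷ []) ∼⊗ ((u , rv , n) ∷ [])
      ∼-bal₁₃ : ∀ r {u ru} v n → proj₁ ru ≈ r * proj₁ u →
                ((ru , v , n) ∷ []) ∼⊗ ((u , v , r *ₗ n) ∷ [])

  ⊗map : ∀ {p} {𝔪 : Ideal p} {N : Module R a b} {N' : Module R a' b'} →
         (Module.Carrierᴹ N → Module.Carrierᴹ N') →
         List (Triple 𝔪 N) → List (Triple 𝔪 N')
  ⊗map f = map (λ { (u , v , n) → (u , v , f n) })

  -- 𝔪 ⊗_R 𝔪 is a flat R-module: tensoring with it preserves injectivity
  -- of linear maps.
  FlatSq : ∀ {p} → Ideal p → Setω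
  FlatSq 𝔪 = ∀ {a b a' b'} (N : Module R a b) (N' : Module R a' b')
             (f : Module.Carrierᴹ N → Module.Carrierᴹ N') →
             IsInjectiveLinear N N' f →
             ∀ xs ys → _∼⊗_ 𝔪 N' (⊗map {𝔪 = 𝔪} {N} {N'} f xs) (⊗map {𝔪 = 𝔪} {N} {N'} f ys) →
             _∼⊗_ 𝔪 N xs ys

  record AlmostSetup (p : Level) : Setω where
    field
      𝔪           : Ideal p
      idempotent  : IsIdempotent 𝔪
      flat        : FlatSq 𝔪

  module _ (A : Module R a b) (B : Module R a b) (C : Module R a b)
           (f : Module.Carrierᴹ A → Module.Carrierᴹ B)
           (g : Module.Carrierᴹ B → Module.Carrierᴹ C) where
    private
      module A = Module A
      module B = Module B
      module C = Module C

    IsComplex : Set (a ⊔ b)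
    IsComplex = ∀ x → g (f x) C.≈ᴹ C.0ᴹ

    -- cohomology at A (= ker f) and at B (= ker g / im f) are almost
    -- zero, i.e. killed by every element of 𝔪.
    IsAlmostExact : ∀ {p} → Ideal p → Set (c ⊔ p ⊔ a ⊔ b)
    IsAlmostExact 𝔪 =
      (∀ r → r ∈ᴵ → ∀ x → f x B.≈ᴹ B.0ᴹ → r A.*ₗ x A.≈ᴹ A.0ᴹ) ×
      (∀ r → r ∈ᴵ → ∀ y → g y C.≈ᴹ C.0ᴹ → ∃ λ x → f x B.≈ᴹ r B.*ₗ y)
      where open Ideal 𝔪

  module _ (M : ℕ → Module R a b)
           (ω : ∀ t → Module.Carrierᴹ (M (sucℕ t)) → Module.Carrierᴹ (M t))
           (ωlin : ∀ t → IsLinear (M (sucℕ t)) (M t) (ω t)) where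
    private
      module M t = Module (M t)
      module W t = ModuleMorphisms.IsModuleHomomorphism (ωlin t)

    LimCarrier : Set (a ⊔ b)
    LimCarrier = Σ (∀ t → M.Carrierᴹ t) λ x → ∀ t → M._≈ᴹ_ t (ω t (x (sucℕ t))) (x t)

    private
      _≈L_ : LimCarrier → LimCarrier → Set b
      x ≈L y = ∀ t → M._≈ᴹ_ t (proj₁ x t) (proj₁ y t)

      0L : LimCarrier
      0L = (λ t → M.0ᴹ t) , λ t → W.0ᴹ-homo t

      _+L_ : LimCarrier → LimCarrier → LimCarrier
      x +L y = (λ t → M._+ᴹ_ t (proj₁ x t) (proj₁ y t)) ,
        λ t → M.≈ᴹ-trans t (W.+ᴹ-homo t _ _) (M.+ᴹ-cong t (proj₂ x t) (proj₂ y t))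

      -L_ : LimCarrier → LimCarrier
      -L x = (λ t → M.-ᴹ_ t (proj₁ x t)) ,
        λ t → M.≈ᴹ-trans t (W.-ᴹ-homo t _) (M.-ᴹ‿cong t (proj₂ x t))

      _*L_ : Carrier → LimCarrier → LimCarrier
      r *L x = (λ t → M._*ₗ_ t r (proj₁ x t)) ,
        λ t → M.≈ᴹ-trans t (W.*ₗ-homo t r _) (M.*ₗ-cong t refl (proj₂ x t))

      isLimModule : IsModuleFromLeft R _≈L_ _+L_ 0L -L_ _*L_
      isLimModule = record { isLeftModule = record
        { isLeftSemimodule = record
          { +ᴹ-isCommutativeMonoid = record
            { isMonoid = record
              { isSemigroup = record
                { isMagma = record
                  { isEquivalence = record
                    { refl = λ t → M.≈ᴹ-refl t
                    ; sym = λ p t → M.≈ᴹ-sym t (p t)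
                    ; trans = λ p q t → M.≈ᴹ-trans t (p t) (q t) }
                  ; ∙-cong = λ p q t → M.+ᴹ-cong t (p t) (q t) }
                ; assoc = λ x y z t → M.+ᴹ-assoc t _ _ _ }
              ; identity = (λ x t → M.+ᴹ-identityˡ t _) , (λ x t → M.+ᴹ-identityʳ t _) }
            ; comm = λ x y t → M.+ᴹ-comm t _ _ }
          ; isPreleftSemimodule = record
            { *ₗ-cong = λ p q t → M.*ₗ-cong t p (q t)
            ; *ₗ-zeroˡ = λ x t → M.*ₗ-zeroˡ t _
            ; *ₗ-distribʳ = λ x r s t → M.*ₗ-distribʳ t _ _ _
            ; *ₗ-identityˡ = λ x t → M.*ₗ-identityˡ t _
            ; *ₗ-assoc = λ r s x t → M.*ₗ-assoc t _ _ _
            ; *ₗ-zeroʳ = λ r t → M.*ₗ-zeroʳ t _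
            ; *ₗ-distribˡ = λ r x y t → M.*ₗ-distribˡ t _ _ _ } }
        ; -ᴹ‿cong = λ p t → M.-ᴹ‿cong t (p t)
        ; -ᴹ‿inverse = (λ x t → M.-ᴹ‿inverseˡ t _) , (λ x t → M.-ᴹ‿inverseʳ t _) } }

    Lim : Module R (a ⊔ b) b
    Lim = record
      { Carrierᴹ = LimCarrier
      ; _≈ᴹ_ = _≈L_
      ; _+ᴹ_ = _+L_
      ; _*ₗ_ = _*L_
      ; _*ᵣ_ = flip _*L_
      ; 0ᴹ = 0L
      ; -ᴹ_ = -L_
      ; isModule = IsModuleFromLeft.isModule isLimModule }

  limMap : (M N : ℕ → Module R a b)
           (ωM : ∀ t → Module.Carrierᴹ (M (sucℕ t)) → Module.Carrierᴹ (M t))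
           (ωMlin : ∀ t → IsLinear (M (sucℕ t)) (M t) (ωM t))
           (ωN : ∀ t → Module.Carrierᴹ (N (sucℕ t)) → Module.Carrierᴹ (N t))
           (ωNlin : ∀ t → IsLinear (N (sucℕ t)) (N t) (ωN t))
           (h : ∀ t → Module.Carrierᴹ (M t) → Module.Carrierᴹ (N t))
           (hlin : ∀ t → IsLinear (M t) (N t) (h t))
           (comm : ∀ t x → Module._≈ᴹ_ (N t) (h t (ωM t x)) (ωN t (h (sucℕ t) x))) →
           LimCarrier M ωM ωMlin → LimCarrier N ωN ωNlin
  limMap M N ωM ωMlin ωN ωNlin h hlin comm x =
    (λ t → h t (proj₁ x t)) ,
    λ t → Module.≈ᴹ-trans (N t) (Module.≈ᴹ-sym (N t) (comm t _))
            (ModuleMorphisms.IsModuleHomomorphism.⟦⟧-cong (hlin t) (proj₂ x t))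

-- Ker φ_t is almost zero for each t, so it is on the limit. For the cokernel, let r ∈ 𝔪 and let y
-- be a compatible family with ψ y = 0. Every v ∈ 𝔪 gives lifts x_t(v) with φ_t x_t(v) = v y_t;
-- they need not be compatible, but ω x_{t+1}(v) − x_t(v) lies in Ker φ_t, so for u ∈ 𝔪 the
-- elements u x_t(v) are. Writing r = Σ uᵢ vᵢ (𝔪² = 𝔪), the compatible family Σ uᵢ x_t(vᵢ)
-- is a lift of r y.
module Submission where

open import Defs
open import Level using (Level; _⊔_)
open import Data.Nat using (ℕ; suc)
open import Data.Product using (_×_; _,_; proj₁; proj₂; ∃)
open import Data.List using (List; []; _∷_; foldr)
open import Algebra.Bundles using (CommutativeRing)
open import Algebra.Module.Bundles using (Module)
open import Algebra.Module.Morphism.Structures using (module ModuleMorphisms)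
import Algebra.Properties.Group as GroupProperties
import Relation.Binary.Reasoning.Setoid as ≈-Reasoning

private
  variable
    a b a' b' : Level

module _ {c ℓ p} {R : CommutativeRing c ℓ} (𝔪 : Ideal R p) where
  open CommutativeRing R
  open Ideal 𝔪

  HasAlmostZeroKernel : (A : Module R a b) (B : Module R a' b') →
                        (Module.Carrierᴹ A → Module.Carrierᴹ B) → Set (c ⊔ p ⊔ a ⊔ b ⊔ b')
  HasAlmostZeroKernel A B f =
    ∀ r → r ∈ᴵ → ∀ x → f x B.≈ᴹ B.0ᴹ → r A.*ₗ x A.≈ᴹ A.0ᴹ
    where module A = Module A
          module B = Module B

  almostZeroKernel⇒*ₗ-cong : (A : Module R a b) (B : Module R a' b')
    {f : Module.Carrierᴹ A → Module.Carrierᴹ B} → IsLinear R A B f →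
    HasAlmostZeroKernel A B f →
    ∀ {u} → u ∈ᴵ → ∀ {x x'} → Module._≈ᴹ_ B (f x) (f x') →
    Module._≈ᴹ_ A (Module._*ₗ_ A u x) (Module._*ₗ_ A u x')
  almostZeroKernel⇒*ₗ-cong A B {f} f-lin ker {u} u∈ {x} {x'} fx≈fx' = begin
    u *ₗ x                  ≈⟨ *ₗ-congˡ (≈ᴹ-sym (//-rightDividesˡ x' x)) ⟩
    u *ₗ (d +ᴹ x')          ≈⟨ *ₗ-distribˡ u d x' ⟩
    u *ₗ d +ᴹ u *ₗ x'       ≈⟨ +ᴹ-congʳ (ker u u∈ d fd≈0) ⟩
    0ᴹ +ᴹ u *ₗ x'           ≈⟨ +ᴹ-identityˡ _ ⟩
    u *ₗ x'                 ∎
    where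
      open Module A
      open ≈-Reasoning ≈ᴹ-setoid
      open GroupProperties +ᴹ-group using (//-rightDividesˡ)
      module B = Module B
      module F = ModuleMorphisms.IsModuleHomomorphism f-lin
      d = x +ᴹ -ᴹ x'
      fd≈0 : f d B.≈ᴹ B.0ᴹ
      fd≈0 = B.≈ᴹ-trans (F.+ᴹ-homo x (-ᴹ x'))
               (B.≈ᴹ-trans (B.+ᴹ-congˡ (F.-ᴹ-homo x'))
                 (GroupProperties.x≈y⇒x∙y⁻¹≈ε B.+ᴹ-group fx≈fx'))

  productSum : List (Elt R 𝔪 × Elt R 𝔪) → Carrier
  productSum = foldr (λ uv s → proj₁ (proj₁ uv) * proj₁ (proj₂ uv) + s) 0#

  weightedSum : (M : Module R a b) → List (Elt R 𝔪 × Elt R 𝔪) →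
                (∀ v → v ∈ᴵ → Module.Carrierᴹ M) → Module.Carrierᴹ M
  weightedSum M [] X = Module.0ᴹ M
  weightedSum M (((u , _) , (v , v∈)) ∷ ps) X =
    Module._+ᴹ_ M (Module._*ₗ_ M u (X v v∈)) (weightedSum M ps X)

  weightedSum-cong : (M : Module R a b) (ps : List (Elt R 𝔪 × Elt R 𝔪))
    {X Y : ∀ v → v ∈ᴵ → Module.Carrierᴹ M} →
    (∀ {u} → u ∈ᴵ → ∀ v (v∈ : v ∈ᴵ) →
       Module._≈ᴹ_ M (Module._*ₗ_ M u (X v v∈)) (Module._*ₗ_ M u (Y v v∈))) →
    Module._≈ᴹ_ M (weightedSum M ps X) (weightedSum M ps Y)
  weightedSum-cong M [] X≈Y = Module.≈ᴹ-refl M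
  weightedSum-cong M (((u , u∈) , (v , v∈)) ∷ ps) X≈Y =
    Module.+ᴹ-cong M (X≈Y u∈ v v∈) (weightedSum-cong M ps X≈Y)

  weightedSum-homo : (M : Module R a b) (N : Module R a' b')
    {f : Module.Carrierᴹ M → Module.Carrierᴹ N} → IsLinear R M N f →
    ∀ ps (X : ∀ v → v ∈ᴵ → Module.Carrierᴹ M) →
    Module._≈ᴹ_ N (f (weightedSum M ps X)) (weightedSum N ps (λ v v∈ → f (X v v∈)))
  weightedSum-homo M N f-lin [] X = F.0ᴹ-homo
    where module F = ModuleMorphisms.IsModuleHomomorphism f-lin
  weightedSum-homo M N {f} f-lin (((u , _) , (v , v∈)) ∷ ps) X =
    ≈ᴹ-trans (F.+ᴹ-homo _ _)
      (+ᴹ-cong (F.*ₗ-homo u (X v v∈)) (weightedSum-homo M N f-lin ps X))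
    where open Module N
          module F = ModuleMorphisms.IsModuleHomomorphism f-lin

  weightedSum-*ₗ : (M : Module R a b) (ps : List (Elt R 𝔪 × Elt R 𝔪)) (y : Module.Carrierᴹ M) →
    Module._≈ᴹ_ M (weightedSum M ps (λ v _ → Module._*ₗ_ M v y)) (Module._*ₗ_ M (productSum ps) y)
  weightedSum-*ₗ M [] y = ≈ᴹ-sym (*ₗ-zeroˡ y)
    where open Module M
  weightedSum-*ₗ M (((u , _) , (v , _)) ∷ ps) y = begin
    u *ₗ (v *ₗ y) +ᴹ weightedSum M ps (λ w _ → w *ₗ y)
      ≈⟨ +ᴹ-cong (≈ᴹ-sym (*ₗ-assoc u v y)) (weightedSum-*ₗ M ps y) ⟩
    (u * v) *ₗ y +ᴹ productSum ps *ₗ y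
      ≈⟨ *ₗ-distribʳ y _ _ ⟨
    (u * v + productSum ps) *ₗ y
      ∎
    where open Module M
          open ≈-Reasoning ≈ᴹ-setoid

  module _ (M₁ M₂ : ℕ → Module R a b)
    (ω₁ : ∀ t → Module.Carrierᴹ (M₁ (suc t)) → Module.Carrierᴹ (M₁ t))
    (ω₁lin : ∀ t → IsLinear R (M₁ (suc t)) (M₁ t) (ω₁ t))
    (ω₂ : ∀ t → Module.Carrierᴹ (M₂ (suc t)) → Module.Carrierᴹ (M₂ t))
    (ω₂lin : ∀ t → IsLinear R (M₂ (suc t)) (M₂ t) (ω₂ t))
    (φ : ∀ t → Module.Carrierᴹ (M₁ t) → Module.Carrierᴹ (M₂ t))
    (φlin : ∀ t → IsLinear R (M₁ t) (M₂ t) (φ t))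
    (sqφ : ∀ t x → Module._≈ᴹ_ (M₂ t) (φ t (ω₁ t x)) (ω₂ t (φ (suc t) x)))
    (ker : ∀ t → HasAlmostZeroKernel (M₁ t) (M₂ t) (φ t)) where
    private
      module M₁ t = Module (M₁ t)
      module M₂ t = Module (M₂ t)
      module L₂ = Module (Lim R M₂ ω₂ ω₂lin)
      module Ω₂ t = ModuleMorphisms.IsModuleHomomorphism (ω₂lin t)

    limMap-almostZeroKernel :
      HasAlmostZeroKernel (Lim R M₁ ω₁ ω₁lin) (Lim R M₂ ω₂ ω₂lin)
        (limMap R M₁ M₂ ω₁ ω₁lin ω₂ ω₂lin φ φlin sqφ)
    limMap-almostZeroKernel r r∈ x φx≈0 t = ker t r r∈ (proj₁ x t) (φx≈0 t)

    limMap-lifts-*ₗ : IsIdempotent R 𝔪 → (y : LimCarrier R M₂ ω₂ ω₂lin) →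
      (∀ t v → v ∈ᴵ → ∃ λ x → M₂._≈ᴹ_ t (φ t x) (M₂._*ₗ_ t v (proj₁ y t))) →
      ∀ r → r ∈ᴵ → ∃ λ x → limMap R M₁ M₂ ω₁ ω₁lin ω₂ ω₂lin φ φlin sqφ x L₂.≈ᴹ r L₂.*ₗ y
    limMap-lifts-*ₗ idem y lift r r∈ =
      (z , z-compatible) ,
      λ t → M₂.≈ᴹ-trans t (φz≈productSum*y t)
              (M₂.*ₗ-cong t (sym r≈productSum) (M₂.≈ᴹ-refl t))
      where
        ps : List (Elt R 𝔪 × Elt R 𝔪)
        ps = proj₁ (idem r r∈)

        r≈productSum : r ≈ productSum ps
        r≈productSum = proj₂ (idem r r∈)

        X : ∀ t v → v ∈ᴵ → M₁.Carrierᴹ t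
        X t v v∈ = proj₁ (lift t v v∈)

        φX≈v*y : ∀ t v (v∈ : v ∈ᴵ) → M₂._≈ᴹ_ t (φ t (X t v v∈)) (M₂._*ₗ_ t v (proj₁ y t))
        φX≈v*y t v v∈ = proj₂ (lift t v v∈)

        φωX≈φX : ∀ t v (v∈ : v ∈ᴵ) → M₂._≈ᴹ_ t (φ t (ω₁ t (X (suc t) v v∈))) (φ t (X t v v∈))
        φωX≈φX t v v∈ = begin
          φ t (ω₁ t (X (suc t) v v∈))          ≈⟨ sqφ t _ ⟩
          ω₂ t (φ (suc t) (X (suc t) v v∈))    ≈⟨ Ω₂.⟦⟧-cong t (φX≈v*y (suc t) v v∈) ⟩
          ω₂ t (M₂._*ₗ_ (suc t) v (proj₁ y (suc t)))  ≈⟨ Ω₂.*ₗ-homo t v _ ⟩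
          v *ₗ ω₂ t (proj₁ y (suc t))          ≈⟨ *ₗ-congˡ (proj₂ y t) ⟩
          v *ₗ proj₁ y t                       ≈⟨ φX≈v*y t v v∈ ⟨
          φ t (X t v v∈)                       ∎
          where open Module (M₂ t)
                open ≈-Reasoning ≈ᴹ-setoid

        z : ∀ t → M₁.Carrierᴹ t
        z t = weightedSum (M₁ t) ps (X t)

        z-compatible : ∀ t → M₁._≈ᴹ_ t (ω₁ t (z (suc t))) (z t)
        z-compatible t =
          M₁.≈ᴹ-trans t (weightedSum-homo (M₁ (suc t)) (M₁ t) (ω₁lin t) ps (X (suc t)))
            (weightedSum-cong (M₁ t) ps λ u∈ v v∈ →
              almostZeroKernel⇒*ₗ-cong (M₁ t) (M₂ t) (φlin t) (ker t) u∈ (φωX≈φX t v v∈))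

        φz≈productSum*y : ∀ t → M₂._≈ᴹ_ t (φ t (z t)) (M₂._*ₗ_ t (productSum ps) (proj₁ y t))
        φz≈productSum*y t = begin
          φ t (z t)
            ≈⟨ weightedSum-homo (M₁ t) (M₂ t) (φlin t) ps (X t) ⟩
          weightedSum (M₂ t) ps (λ v v∈ → φ t (X t v v∈))
            ≈⟨ weightedSum-cong (M₂ t) ps (λ _ v v∈ → *ₗ-congˡ (φX≈v*y t v v∈)) ⟩
          weightedSum (M₂ t) ps (λ v _ → v *ₗ proj₁ y t)
            ≈⟨ weightedSum-*ₗ (M₂ t) ps (proj₁ y t) ⟩
          productSum ps *ₗ proj₁ y t
            ∎
          where open Module (M₂ t)
                open ≈-Reasoning ≈ᴹ-setoid

lemmaB4 : ∀ {c ℓ p a b : Level} (R : CommutativeRing c ℓ) (S : AlmostSetup R p)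
    (M₁ M₂ M₃ : ℕ → Module R a b)
    (φ : ∀ t → Module.Carrierᴹ (M₁ t) → Module.Carrierᴹ (M₂ t))
    (φlin : ∀ t → IsLinear R (M₁ t) (M₂ t) (φ t))
    (ψ : ∀ t → Module.Carrierᴹ (M₂ t) → Module.Carrierᴹ (M₃ t))
    (ψlin : ∀ t → IsLinear R (M₂ t) (M₃ t) (ψ t))
    (cpx : ∀ t → IsComplex R (M₁ t) (M₂ t) (M₃ t) (φ t) (ψ t))
    (ω₁ : ∀ t → Module.Carrierᴹ (M₁ (suc t)) → Module.Carrierᴹ (M₁ t))
    (ω₁lin : ∀ t → IsLinear R (M₁ (suc t)) (M₁ t) (ω₁ t))
    (ω₂ : ∀ t → Module.Carrierᴹ (M₂ (suc t)) → Module.Carrierᴹ (M₂ t))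
    (ω₂lin : ∀ t → IsLinear R (M₂ (suc t)) (M₂ t) (ω₂ t))
    (ω₃ : ∀ t → Module.Carrierᴹ (M₃ (suc t)) → Module.Carrierᴹ (M₃ t))
    (ω₃lin : ∀ t → IsLinear R (M₃ (suc t)) (M₃ t) (ω₃ t))
    (sqφ : ∀ t x → Module._≈ᴹ_ (M₂ t) (φ t (ω₁ t x)) (ω₂ t (φ (suc t) x)))
    (sqψ : ∀ t x → Module._≈ᴹ_ (M₃ t) (ψ t (ω₂ t x)) (ω₃ t (ψ (suc t) x))) →
    (∀ t → IsAlmostExact R (M₁ t) (M₂ t) (M₃ t) (φ t) (ψ t) (AlmostSetup.𝔪 S)) →
    IsAlmostExact R (Lim R M₁ ω₁ ω₁lin) (Lim R M₂ ω₂ ω₂lin) (Lim R M₃ ω₃ ω₃lin)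
    (limMap R M₁ M₂ ω₁ ω₁lin ω₂ ω₂lin φ φlin sqφ)
    (limMap R M₂ M₃ ω₂ ω₂lin ω₃ ω₃lin ψ ψlin sqψ)
    (AlmostSetup.𝔪 S)
lemmaB4 R S M₁ M₂ M₃ φ φlin ψ ψlin _ ω₁ ω₁lin ω₂ ω₂lin ω₃ ω₃lin sqφ sqψ exact =
  limMap-almostZeroKernel 𝔪 M₁ M₂ ω₁ ω₁lin ω₂ ω₂lin φ φlin sqφ ker ,
  λ r r∈ y ψy≈0 →
    limMap-lifts-*ₗ 𝔪 M₁ M₂ ω₁ ω₁lin ω₂ ω₂lin φ φlin sqφ ker idempotent y
      (λ t v v∈ → proj₂ (exact t) v v∈ (proj₁ y t) (ψy≈0 t)) r r∈
  where
    open AlmostSetup S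
    ker : ∀ t → HasAlmostZeroKernel 𝔪 (M₁ t) (M₂ t) (φ t)
    ker t = proj₁ (exact t)
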